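{- Let $n$ be a positive integer, let $a_n$ and $c$ be integers, and let $x,y$ be real or complex numbers with $x\neq0$, $y\neq0$, $x+y\neq 0$. Then \[ \sum_{a_{n-1}=c}^{a_n}\sum_{a_{n-2}=c}^{a_{n-1}}\cdots\sum_{a_0=c}^{a_1}(-1)^{a_0}\left(\frac{x}{y}\right)^{a_0} =(-1)^{a_n}\left(\frac{x}{x+y}\right)^n\left(\frac{x}{y}\right)^{a_n}+(-1)^c\sum_{j=0}^{n-1}\left(\frac{x}{x+y}\right)^{n-j}\left(\frac{x}{y}\right)^{c-1}\binom{a_n+j-c}{j}. \]
   Context: The left side is an iterated sum with $n$ summation signs: $a_{n-1}$ runs from $c$ to $a_n$, and for each $i$ the index $a_{i-1}$ runs from $c$ to $a_i$. Summation convention: for integers $m,M$, $\sum_{k=m}^{M}h(k)$ is the usual sum if $M\ge m$, equals $0$ if $M=m-1$, and equals $-\sum_{k=M+1}^{m-1}h(k)$ if $M\le m-2$. For an integer $N$ and a non-negative integer $j$, $\binom{N}{j}=N(N-1)\cdots(N-j+1)/j!$. -}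

module Defs where

open import Level using (Level; _⊔_; suc)
open import Data.Nat as ℕ using (ℕ; zero; _!)
open import Data.Nat.Properties using (_!≢0)
open import Data.Integer as ℤ using (ℤ; +_; -[1+_]; _/ℕ_)
open import Algebra.Bundles using (CommutativeRing)
open import Relation.Nullary using (¬_)

record Field (c ℓ : Level) : Set (suc (c ⊔ ℓ)) where
  field
    commutativeRing : CommutativeRing c ℓ
  open CommutativeRing commutativeRing public
  field
    _⁻¹       : Carrier → Carrier
    ⁻¹-cong   : ∀ {x y} → x ≈ y → x ⁻¹ ≈ y ⁻¹
    ⁻¹-inverse : ∀ x → ¬ (x ≈ 0#) → x * (x ⁻¹) ≈ 1#
    0≉1       : ¬ (0# ≈ 1#)

-- Integer binomial coefficient  (N choose j) = N(N-1)...(N-j+1) / j!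
-- (an exact division, computed in ℤ).
fallingℤ : ℤ → ℕ → ℤ
fallingℤ N zero        = + 1
fallingℤ N (ℕ.suc j)   = fallingℤ N j ℤ.* (N ℤ.- + j)

binomℤ : ℤ → ℕ → ℤ
binomℤ N j = fallingℤ N j /ℕ (j !)
  where instance _ = j !≢0

module FieldOps {c ℓ} (F : Field c ℓ) where
  open Field F

  pow : Carrier → ℕ → Carrier
  pow r zero      = 1#
  pow r (ℕ.suc n) = r * pow r n

  zpow : Carrier → ℤ → Carrier
  zpow r (+ n)     = pow r n
  zpow r -[1+ n ]  = pow (r ⁻¹) (ℕ.suc n)

  fromℕ : ℕ → Carrier
  fromℕ zero      = 0#
  fromℕ (ℕ.suc n) = 1# + fromℕ n

  fromℤ : ℤ → Carrier
  fromℤ (+ n)    = fromℕ n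
  fromℤ -[1+ n ] = - fromℕ (ℕ.suc n)

  sumℕ : ℕ → (ℕ → Carrier) → Carrier
  sumℕ zero      h = 0#
  sumℕ (ℕ.suc k) h = sumℕ k h + h k

  -- sum_{k=m}^{M} h k with the convention: usual sum if M ≥ m,
  -- 0 if M = m-1, and - sum_{k=M+1}^{m-1} h k if M ≤ m-2.
  zsum : ℤ → ℤ → (ℤ → Carrier) → Carrier
  zsum m M h with M ℤ.- m ℤ.+ + 1
  ... | + k      = sumℕ k (λ i → h (m ℤ.+ + i))
  ... | -[1+ k ] = - sumℕ (ℕ.suc k) (λ i → h ((M ℤ.+ + 1) ℤ.+ + i))

  iterSum : ℤ → ℕ → (ℤ → Carrier) → ℤ → Carrier
  iterSum c zero      f a = f a
  iterSum c (ℕ.suc n) f a = zsum c a (λ b → iterSum c n f b)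

  _/_ : Carrier → Carrier → Carrier
  x / y = x * (y ⁻¹)

{-# OPTIONS --safe #-}
module Submission where

-- Let S_n(a) be the iterated sum as a function of its upper limit a. Under the summation
-- convention, S_{n+1} is the unique function G on ℤ with G(c-1) = 0 and
-- G(a) = G(a-1) + S_n(a) for all a, so by induction on n it suffices that the right-hand
-- side R_n has the same two properties. With q = x/(x+y) and r = x/y one has q(r+1) = r,
-- which is exactly the difference equation for the term (-1)^a q^n r^a; the binomial sum
-- satisfies it by Pascal's rule; and at a = c-1 every binomial C(j-1, j) vanishes except
-- the one for j = 0, whose term cancels the first. Nothing uses n ≠ 0.

open import Defs
open import Level using (Level)
open import Data.Nat as ℕ using (ℕ; NonZero; zero; suc; _!)
import Data.Nat.Properties as ℕP
import Data.Nat.DivMod as ℕD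
open import Data.Integer as ℤ using (ℤ; +_; -[1+_]; _/ℕ_)
import Data.Integer.Properties as ℤP
import Data.Integer.Tactic.RingSolver as ℤSolver
open import Data.Product using (Σ; _,_)
open import Data.Sum using (inj₁; inj₂)
import Relation.Binary.PropositionalEquality as ≡
open ≡ using (_≡_)
open import Relation.Nullary using (¬_)

ℤ-ind : ∀ {p} (P : ℤ → Set p) → P (+ 0) →
        (∀ i → P i → P (i ℤ.+ + 1)) → (∀ i → P (i ℤ.+ + 1) → P i) → ∀ i → P i
ℤ-ind P base up down (+ zero)     = base
ℤ-ind P base up down (+ suc n)    =
  ≡.subst P (≡.cong +_ (ℕP.+-comm n 1)) (up (+ n) (ℤ-ind P base up down (+ n)))
ℤ-ind P base up down -[1+ zero ]  = down -[1+ zero ] base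
ℤ-ind P base up down -[1+ suc n ] = down -[1+ suc n ] (ℤ-ind P base up down -[1+ n ])

fallingℤ-shift : ∀ N j → fallingℤ (N ℤ.+ + 1) (suc j) ≡ (N ℤ.+ + 1) ℤ.* fallingℤ N j
fallingℤ-shift N zero    = base N
  where
  base : ∀ N → + 1 ℤ.* ((N ℤ.+ + 1) ℤ.- + 0) ≡ (N ℤ.+ + 1) ℤ.* + 1
  base = ℤSolver.solve-∀
fallingℤ-shift N (suc j) = begin
  fallingℤ (N ℤ.+ + 1) (suc j) ℤ.* ((N ℤ.+ + 1) ℤ.- + suc j)
    ≡⟨ ≡.cong (ℤ._* ((N ℤ.+ + 1) ℤ.- + suc j)) (fallingℤ-shift N j) ⟩
  (N ℤ.+ + 1) ℤ.* fallingℤ N j ℤ.* ((N ℤ.+ + 1) ℤ.- (+ 1 ℤ.+ + j))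
    ≡⟨ reassociate N (fallingℤ N j) (+ j) ⟩
  (N ℤ.+ + 1) ℤ.* (fallingℤ N j ℤ.* (N ℤ.- + j)) ∎
  where
  open ≡.≡-Reasoning
  reassociate : ∀ N F J → (N ℤ.+ + 1) ℤ.* F ℤ.* ((N ℤ.+ + 1) ℤ.- (+ 1 ℤ.+ J))
                          ≡ (N ℤ.+ + 1) ℤ.* (F ℤ.* (N ℤ.- J))
  reassociate = ℤSolver.solve-∀

fallingℤ-pascal : ∀ N j →
  fallingℤ (N ℤ.+ + 1) (suc j) ≡ fallingℤ N (suc j) ℤ.+ + suc j ℤ.* fallingℤ N j
fallingℤ-pascal N j = ≡.trans (fallingℤ-shift N j) (expand N (fallingℤ N j) (+ j))
  where
  expand : ∀ N F J → (N ℤ.+ + 1) ℤ.* F ≡ F ℤ.* (N ℤ.- J) ℤ.+ (+ 1 ℤ.+ J) ℤ.* F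
  expand = ℤSolver.solve-∀

fallingℤ-vanish : ∀ m j → m ℕ.< j → fallingℤ (+ m) j ≡ + 0
fallingℤ-vanish m (suc j) m<1+j with ℕP.m<1+n⇒m<n∨m≡n m<1+j
... | inj₁ m<j    = ≡.trans (≡.cong (ℤ._* (+ m ℤ.- + j)) (fallingℤ-vanish m j m<j))
                            (ℤP.*-zeroˡ (+ m ℤ.- + j))
... | inj₂ ≡.refl = ≡.trans (≡.cong (fallingℤ (+ m) m ℤ.*_) (ℤP.+-inverseʳ (+ m)))
                            (ℤP.*-zeroʳ (fallingℤ (+ m) m))

[1+j]!≡[1+j]*j! : ∀ j → + (suc j !) ≡ + suc j ℤ.* + (j !)
[1+j]!≡[1+j]*j! j = ℤP.pos-* (suc j) (j !)

fallingℤ-multiple-up : ∀ N j k k′ →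
  fallingℤ N (suc j) ≡ k ℤ.* + (suc j !) → fallingℤ N j ≡ k′ ℤ.* + (j !) →
  fallingℤ (N ℤ.+ + 1) (suc j) ≡ (k ℤ.+ k′) ℤ.* + (suc j !)
fallingℤ-multiple-up N j k k′ e e′ = begin
  fallingℤ (N ℤ.+ + 1) (suc j)                ≡⟨ fallingℤ-pascal N j ⟩
  fallingℤ N (suc j) ℤ.+ s ℤ.* fallingℤ N j   ≡⟨ ≡.cong₂ (λ u v → u ℤ.+ s ℤ.* v) e e′ ⟩
  k ℤ.* f′ ℤ.+ s ℤ.* (k′ ℤ.* f)               ≡⟨ ≡.cong (λ z → k ℤ.* z ℤ.+ s ℤ.* (k′ ℤ.* f)) ([1+j]!≡[1+j]*j! j) ⟩
  k ℤ.* (s ℤ.* f) ℤ.+ s ℤ.* (k′ ℤ.* f)        ≡⟨ collect k k′ s f ⟩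
  (k ℤ.+ k′) ℤ.* (s ℤ.* f)                    ≡⟨ ≡.cong ((k ℤ.+ k′) ℤ.*_) ([1+j]!≡[1+j]*j! j) ⟨
  (k ℤ.+ k′) ℤ.* f′                           ∎
  where
  open ≡.≡-Reasoning
  s f f′ : ℤ
  s  = + suc j
  f  = + (j !)
  f′ = + (suc j !)
  collect : ∀ K K′ S J → K ℤ.* (S ℤ.* J) ℤ.+ S ℤ.* (K′ ℤ.* J) ≡ (K ℤ.+ K′) ℤ.* (S ℤ.* J)
  collect = ℤSolver.solve-∀

fallingℤ-multiple-down : ∀ N j k k′ →
  fallingℤ (N ℤ.+ + 1) (suc j) ≡ k ℤ.* + (suc j !) → fallingℤ N j ≡ k′ ℤ.* + (j !) →
  fallingℤ N (suc j) ≡ (k ℤ.- k′) ℤ.* + (suc j !)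
fallingℤ-multiple-down N j k k′ e e′ = begin
  fallingℤ N (suc j)                                ≡⟨ add-sub (fallingℤ N (suc j)) (s ℤ.* fallingℤ N j) ⟩
  fallingℤ N (suc j) ℤ.+ s ℤ.* fallingℤ N j ℤ.- s ℤ.* fallingℤ N j
                                                    ≡⟨ ≡.cong (ℤ._- s ℤ.* fallingℤ N j) (fallingℤ-pascal N j) ⟨
  fallingℤ (N ℤ.+ + 1) (suc j) ℤ.- s ℤ.* fallingℤ N j ≡⟨ ≡.cong₂ (λ u v → u ℤ.- s ℤ.* v) e e′ ⟩
  k ℤ.* f′ ℤ.- s ℤ.* (k′ ℤ.* f)                     ≡⟨ ≡.cong (λ z → k ℤ.* z ℤ.- s ℤ.* (k′ ℤ.* f)) ([1+j]!≡[1+j]*j! j) ⟩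
  k ℤ.* (s ℤ.* f) ℤ.- s ℤ.* (k′ ℤ.* f)              ≡⟨ collect k k′ s f ⟩
  (k ℤ.- k′) ℤ.* (s ℤ.* f)                          ≡⟨ ≡.cong ((k ℤ.- k′) ℤ.*_) ([1+j]!≡[1+j]*j! j) ⟨
  (k ℤ.- k′) ℤ.* f′                                 ∎
  where
  open ≡.≡-Reasoning
  s f f′ : ℤ
  s  = + suc j
  f  = + (j !)
  f′ = + (suc j !)
  add-sub : ∀ A B → A ≡ A ℤ.+ B ℤ.- B
  add-sub = ℤSolver.solve-∀
  collect : ∀ K K′ S J → K ℤ.* (S ℤ.* J) ℤ.- S ℤ.* (K′ ℤ.* J) ≡ (K ℤ.- K′) ℤ.* (S ℤ.* J)
  collect = ℤSolver.solve-∀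

j!∣fallingℤ : ∀ j N → Σ ℤ λ k → fallingℤ N j ≡ k ℤ.* + (j !)
j!∣fallingℤ zero    N = + 1 , ≡.refl
j!∣fallingℤ (suc j)   = ℤ-ind P (+ 0 , base) up down
  where
  P : ℤ → Set
  P N = Σ ℤ λ k → fallingℤ N (suc j) ≡ k ℤ.* + (suc j !)
  base : fallingℤ (+ 0) (suc j) ≡ + 0 ℤ.* + (suc j !)
  base = ≡.trans (fallingℤ-vanish 0 (suc j) (ℕ.s≤s ℕ.z≤n)) (≡.sym (ℤP.*-zeroˡ (+ (suc j !))))
  up : ∀ N → P N → P (N ℤ.+ + 1)
  up N (k , e) with j!∣fallingℤ j N
  ... | k′ , e′ = k ℤ.+ k′ , fallingℤ-multiple-up N j k k′ e e′
  down : ∀ N → P (N ℤ.+ + 1) → P N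
  down N (k , e) with j!∣fallingℤ j N
  ... | k′ , e′ = k ℤ.- k′ , fallingℤ-multiple-down N j k k′ e e′

[k*d]/ℕd≡k : ∀ k d .{{_ : NonZero d}} → (k ℤ.* + d) /ℕ d ≡ k
[k*d]/ℕd≡k (+ m)    d       =
  ≡.trans (≡.cong (_/ℕ d) (≡.sym (ℤP.pos-* m d))) (≡.cong +_ (ℕD.m*n/n≡m m d))
[k*d]/ℕd≡k -[1+ m ] (suc d) = begin
  (-[1+ m ] ℤ.* + suc d) /ℕ suc d       ≡⟨ ≡.cong (_/ℕ suc d) product ⟩
  -[1+ d ℕ.+ m ℕ.* suc d ] /ℕ suc d     ≡⟨ exact (ℕD.m*n%n≡0 (suc m) (suc d)) ⟩
  ℤ.- (+ (suc m ℕ.* suc d ℕ./ suc d))   ≡⟨ ≡.cong (λ z → ℤ.- (+ z)) (ℕD.m*n/n≡m (suc m) (suc d)) ⟩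
  -[1+ m ]                              ∎
  where
  open ≡.≡-Reasoning
  product : -[1+ m ] ℤ.* + suc d ≡ -[1+ d ℕ.+ m ℕ.* suc d ]
  product = ≡.trans (≡.sym (ℤP.neg-distribˡ-* (+ suc m) (+ suc d)))
                    (≡.cong ℤ.-_ (≡.sym (ℤP.pos-* (suc m) (suc d))))
  exact : ∀ {y} → suc y ℕ.% suc d ≡ 0 → -[1+ y ] /ℕ suc d ≡ ℤ.- (+ (suc y ℕ./ suc d))
  exact {y} r≡0 with suc y ℕ.% suc d
  exact ≡.refl | .0 = ≡.refl

binomℤ-unique : ∀ N j k → fallingℤ N j ≡ k ℤ.* + (j !) → binomℤ N j ≡ k
binomℤ-unique N j k e = ≡.trans (≡.cong (_/ℕ (j !)) e) ([k*d]/ℕd≡k k (j !))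
  where instance _ = j ℕP.!≢0

binomℤ-pascal : ∀ N j → binomℤ (N ℤ.+ + 1) (suc j) ≡ binomℤ N (suc j) ℤ.+ binomℤ N j
binomℤ-pascal N j with j!∣fallingℤ (suc j) N | j!∣fallingℤ j N
... | k , e | k′ , e′ = begin
  binomℤ (N ℤ.+ + 1) (suc j)
    ≡⟨ binomℤ-unique (N ℤ.+ + 1) (suc j) (k ℤ.+ k′) (fallingℤ-multiple-up N j k k′ e e′) ⟩
  k ℤ.+ k′
    ≡⟨ ≡.cong₂ ℤ._+_ (binomℤ-unique N (suc j) k e) (binomℤ-unique N j k′ e′) ⟨
  binomℤ N (suc j) ℤ.+ binomℤ N j
    ∎
  where open ≡.≡-Reasoning

binomℤ-vanish : ∀ m → binomℤ (+ m) (suc m) ≡ + 0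
binomℤ-vanish m = binomℤ-unique (+ m) (suc m) (+ 0)
  (≡.trans (fallingℤ-vanish m (suc m) (ℕP.n<1+n m)) (≡.sym (ℤP.*-zeroˡ (+ (suc m !)))))

reversed-range-end : ∀ a c k →
  a ℤ.- c ℤ.+ + 1 ≡ -[1+ k ] → (a ℤ.+ + 1) ℤ.- + 1 ℤ.+ + suc k ≡ c ℤ.- + 1
reversed-range-end a c k eq = begin
  (a ℤ.+ + 1) ℤ.- + 1 ℤ.+ + suc k                ≡⟨ regroup a c (+ suc k) ⟩
  (a ℤ.- c ℤ.+ + 1) ℤ.+ + suc k ℤ.+ (c ℤ.- + 1)  ≡⟨ ≡.cong (λ z → z ℤ.+ + suc k ℤ.+ (c ℤ.- + 1)) eq ⟩
  -[1+ k ] ℤ.+ + suc k ℤ.+ (c ℤ.- + 1)           ≡⟨ ≡.cong (ℤ._+ (c ℤ.- + 1)) (ℤP.+-inverseˡ (+ suc k)) ⟩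
  + 0 ℤ.+ (c ℤ.- + 1)                            ≡⟨ ℤP.+-identityˡ (c ℤ.- + 1) ⟩
  c ℤ.- + 1                                      ∎
  where
  open ≡.≡-Reasoning
  regroup : ∀ a c z → (a ℤ.+ + 1) ℤ.- + 1 ℤ.+ z ≡ (a ℤ.- c ℤ.+ + 1) ℤ.+ z ℤ.+ (c ℤ.- + 1)
  regroup = ℤSolver.solve-∀

module _ {f ℓ} (F : Field f ℓ) where
  open Field F
  open FieldOps F
  open import Relation.Binary.Reasoning.Setoid setoid
  open import Algebra.Solver.Ring.NaturalCoefficients.Default commutativeSemiring
    using (solve; _:+_; _:*_; _:=_; con)
  open import Algebra.Properties.Group +-group using (∙-cancelʳ; inverseˡ-unique; inverseʳ-unique; ε⁻¹≈ε)

  -1≉0 : ¬ (- 1# ≈ 0#)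
  -1≉0 -1≈0 = 0≉1 (sym (begin
    1#          ≈⟨ +-identityʳ 1# ⟨
    1# + 0#     ≈⟨ +-congˡ -1≈0 ⟨
    1# + - 1#   ≈⟨ -‿inverseʳ 1# ⟩
    0#          ∎))

  r*[r⁻¹*x]≈x : ∀ {r} → ¬ (r ≈ 0#) → ∀ x → r * (r ⁻¹ * x) ≈ x
  r*[r⁻¹*x]≈x {r} r≉0 x = begin
    r * (r ⁻¹ * x)   ≈⟨ *-assoc r (r ⁻¹) x ⟨
    r * r ⁻¹ * x     ≈⟨ *-congʳ (⁻¹-inverse r r≉0) ⟩
    1# * x           ≈⟨ *-identityˡ x ⟩
    x                ∎

  x/y≉0 : ∀ {x y} → ¬ (x ≈ 0#) → ¬ (y ≈ 0#) → ¬ (x / y ≈ 0#)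
  x/y≉0 {x} {y} x≉0 y≉0 x/y≈0 = x≉0 (begin
    x                ≈⟨ r*[r⁻¹*x]≈x y≉0 x ⟨
    y * (y ⁻¹ * x)   ≈⟨ *-congˡ (*-comm (y ⁻¹) x) ⟩
    y * (x / y)      ≈⟨ *-congˡ x/y≈0 ⟩
    y * 0#           ≈⟨ zeroʳ y ⟩
    0#               ∎)

  x/[x+y]*[x/y+1]≈x/y : ∀ {x y} → ¬ (y ≈ 0#) → ¬ (x + y ≈ 0#) → x / (x + y) * (x / y + 1#) ≈ x / y
  x/[x+y]*[x/y+1]≈x/y {x} {y} y≉0 x+y≉0 = begin
    x * (x + y) ⁻¹ * (x * y ⁻¹ + 1#)            ≈⟨ *-congˡ (+-congˡ (⁻¹-inverse y y≉0)) ⟨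
    x * (x + y) ⁻¹ * (x * y ⁻¹ + y * y ⁻¹)      ≈⟨ regroup x y (y ⁻¹) ((x + y) ⁻¹) ⟩
    x * y ⁻¹ * ((x + y) * (x + y) ⁻¹)           ≈⟨ *-congˡ (⁻¹-inverse (x + y) x+y≉0) ⟩
    x * y ⁻¹ * 1#                               ≈⟨ *-identityʳ (x / y) ⟩
    x / y                                       ∎
    where
    regroup : ∀ a b u v → a * v * (a * u + b * u) ≈ a * u * ((a + b) * v)
    regroup = solve 4 (λ a b u v → a :* v :* (a :* u :+ b :* u) := a :* u :* ((a :+ b) :* v)) refl

  zpow-+1 : ∀ {r} → ¬ (r ≈ 0#) → ∀ b → zpow r (b ℤ.+ + 1) ≈ r * zpow r b
  zpow-+1 {r} r≉0 (+ n)        = reflexive (≡.cong (pow r) (ℕP.+-comm n 1))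
  zpow-+1 {r} r≉0 -[1+ zero ]  = sym (r*[r⁻¹*x]≈x r≉0 1#)
  zpow-+1 {r} r≉0 -[1+ suc n ] = sym (r*[r⁻¹*x]≈x r≉0 (pow (r ⁻¹) (suc n)))

  fromℕ-+1 : ∀ n → fromℕ (n ℕ.+ 1) ≈ fromℕ n + 1#
  fromℕ-+1 zero    = +-comm 1# 0#
  fromℕ-+1 (suc n) = trans (+-congˡ (fromℕ-+1 n)) (sym (+-assoc 1# (fromℕ n) 1#))

  -[1+x]+1≈-x : ∀ x → - (1# + x) + 1# ≈ - x
  -[1+x]+1≈-x x = inverseʳ-unique x (- (1# + x) + 1#) (begin
    x + (- (1# + x) + 1#)   ≈⟨ shuffle x (- (1# + x)) ⟩
    1# + x + - (1# + x)     ≈⟨ -‿inverseʳ (1# + x) ⟩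
    0#                      ∎)
    where
    shuffle : ∀ x t → x + (t + 1#) ≈ 1# + x + t
    shuffle = solve 2 (λ x t → x :+ (t :+ con 1) := con 1 :+ x :+ t) refl

  fromℤ-+1 : ∀ i → fromℤ (i ℤ.+ + 1) ≈ fromℤ i + 1#
  fromℤ-+1 (+ n)        = fromℕ-+1 n
  fromℤ-+1 -[1+ zero ]  = sym (trans (-[1+x]+1≈-x 0#) ε⁻¹≈ε)
  fromℤ-+1 -[1+ suc n ] = sym (-[1+x]+1≈-x (1# + fromℕ n))

  fromℤ-+ : ∀ u v → fromℤ (u ℤ.+ v) ≈ fromℤ u + fromℤ v
  fromℤ-+ u = ℤ-ind P base up down
    where
    P : ℤ → Set ℓ
    P v = fromℤ (u ℤ.+ v) ≈ fromℤ u + fromℤ v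
    shift : ∀ v → fromℤ (u ℤ.+ (v ℤ.+ + 1)) ≈ fromℤ (u ℤ.+ v) + 1#
    shift v = trans (reflexive (≡.cong fromℤ (≡.sym (ℤP.+-assoc u v (+ 1))))) (fromℤ-+1 (u ℤ.+ v))
    base : P (+ 0)
    base = trans (reflexive (≡.cong fromℤ (ℤP.+-identityʳ u))) (sym (+-identityʳ (fromℤ u)))
    up : ∀ v → P v → P (v ℤ.+ + 1)
    up v ih = begin
      fromℤ (u ℤ.+ (v ℤ.+ + 1))     ≈⟨ shift v ⟩
      fromℤ (u ℤ.+ v) + 1#          ≈⟨ +-congʳ ih ⟩
      fromℤ u + fromℤ v + 1#        ≈⟨ +-assoc (fromℤ u) (fromℤ v) 1# ⟩
      fromℤ u + (fromℤ v + 1#)      ≈⟨ +-congˡ (fromℤ-+1 v) ⟨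
      fromℤ u + fromℤ (v ℤ.+ + 1)   ∎
    down : ∀ v → P (v ℤ.+ + 1) → P v
    down v ih = ∙-cancelʳ 1# _ _ (begin
      fromℤ (u ℤ.+ v) + 1#          ≈⟨ shift v ⟨
      fromℤ (u ℤ.+ (v ℤ.+ + 1))     ≈⟨ ih ⟩
      fromℤ u + fromℤ (v ℤ.+ + 1)   ≈⟨ +-congˡ (fromℤ-+1 v) ⟩
      fromℤ u + (fromℤ v + 1#)      ≈⟨ +-assoc (fromℤ u) (fromℤ v) 1# ⟨
      fromℤ u + fromℤ v + 1#        ∎)

  sumℕ-cong : ∀ n {g h : ℕ → Carrier} → (∀ i → g i ≈ h i) → sumℕ n g ≈ sumℕ n h
  sumℕ-cong zero    g≈h = refl
  sumℕ-cong (suc n) g≈h = +-cong (sumℕ-cong n g≈h) (g≈h n)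

  sumℕ-head : ∀ n (h : ℕ → Carrier) → sumℕ (suc n) h ≈ h 0 + sumℕ n (λ i → h (suc i))
  sumℕ-head zero    h = trans (+-identityˡ (h 0)) (sym (+-identityʳ (h 0)))
  sumℕ-head (suc n) h = trans (+-congʳ (sumℕ-head n h)) (+-assoc _ _ _)

  sumℕ-+ : ∀ n (g h : ℕ → Carrier) → sumℕ n (λ i → g i + h i) ≈ sumℕ n g + sumℕ n h
  sumℕ-+ zero    g h = sym (+-identityʳ 0#)
  sumℕ-+ (suc n) g h = trans (+-congʳ (sumℕ-+ n g h)) (interchange _ _ _ _)
    where
    interchange : ∀ a b c d → a + b + (c + d) ≈ a + c + (b + d)
    interchange = solve 4 (λ a b c d → a :+ b :+ (c :+ d) := a :+ c :+ (b :+ d)) refl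

  sumℕ-≈0 : ∀ n (h : ℕ → Carrier) → (∀ i → h i ≈ 0#) → sumℕ n h ≈ 0#
  sumℕ-≈0 zero    h h≈0 = refl
  sumℕ-≈0 (suc n) h h≈0 = trans (+-cong (sumℕ-≈0 n h h≈0) (h≈0 n)) (+-identityʳ 0#)

  module _ (h G : ℤ → Carrier) (ΔG : ∀ b → G (b ℤ.+ + 1) ≈ G b + h (b ℤ.+ + 1)) where

    telescope : ∀ e m → G (e ℤ.- + 1) + sumℕ m (λ i → h (e ℤ.+ + i)) ≈ G ((e ℤ.- + 1) ℤ.+ + m)
    telescope e zero    = trans (+-identityʳ _) (reflexive (≡.cong G (≡.sym (ℤP.+-identityʳ _))))
    telescope e (suc m) = begin
      G (e ℤ.- + 1) + (sumℕ m (λ i → h (e ℤ.+ + i)) + h (e ℤ.+ + m))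
        ≈⟨ +-assoc _ _ _ ⟨
      G (e ℤ.- + 1) + sumℕ m (λ i → h (e ℤ.+ + i)) + h (e ℤ.+ + m)
        ≈⟨ +-cong (telescope e m) (reflexive (≡.cong h (index e (+ m)))) ⟩
      G ((e ℤ.- + 1) ℤ.+ + m) + h ((e ℤ.- + 1) ℤ.+ + m ℤ.+ + 1)
        ≈⟨ ΔG ((e ℤ.- + 1) ℤ.+ + m) ⟨
      G ((e ℤ.- + 1) ℤ.+ + m ℤ.+ + 1)
        ≈⟨ reflexive (≡.cong G (ℤP.+-assoc (e ℤ.- + 1) (+ m) (+ 1))) ⟩
      G ((e ℤ.- + 1) ℤ.+ (+ m ℤ.+ + 1))
        ≈⟨ reflexive (≡.cong (λ k → G ((e ℤ.- + 1) ℤ.+ + k)) (ℕP.+-comm m 1)) ⟩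
      G ((e ℤ.- + 1) ℤ.+ + suc m) ∎
      where
      index : ∀ e M → e ℤ.+ M ≡ (e ℤ.- + 1) ℤ.+ M ℤ.+ + 1
      index = ℤSolver.solve-∀

    zsum-unique : ∀ c → G (c ℤ.- + 1) ≈ 0# → ∀ a → zsum c a h ≈ G a
    zsum-unique c G₀ a with a ℤ.- c ℤ.+ + 1 in eq
    ... | + k = begin
      sumℕ k (λ i → h (c ℤ.+ + i))                   ≈⟨ +-identityˡ _ ⟨
      0# + sumℕ k (λ i → h (c ℤ.+ + i))              ≈⟨ +-congʳ G₀ ⟨
      G (c ℤ.- + 1) + sumℕ k (λ i → h (c ℤ.+ + i))   ≈⟨ telescope c k ⟩
      G ((c ℤ.- + 1) ℤ.+ + k)                        ≈⟨ reflexive (≡.cong G a≡end) ⟨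
      G a                                            ∎
      where
      index : ∀ a c → a ≡ (c ℤ.- + 1) ℤ.+ (a ℤ.- c ℤ.+ + 1)
      index = ℤSolver.solve-∀
      a≡end : a ≡ (c ℤ.- + 1) ℤ.+ + k
      a≡end = ≡.trans (index a c) (≡.cong (λ z → (c ℤ.- + 1) ℤ.+ z) eq)
    ... | -[1+ k ] = sym (inverseˡ-unique (G a) S (begin
      G a + S                                        ≈⟨ +-congʳ (reflexive (≡.cong G (index₁ a))) ⟩
      G ((a ℤ.+ + 1) ℤ.- + 1) + S                    ≈⟨ telescope (a ℤ.+ + 1) (suc k) ⟩
      G ((a ℤ.+ + 1) ℤ.- + 1 ℤ.+ + suc k)            ≈⟨ reflexive (≡.cong G (reversed-range-end a c k eq)) ⟩
      G (c ℤ.- + 1)                                  ≈⟨ G₀ ⟩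
      0#                                             ∎))
      where
      S = sumℕ (suc k) (λ i → h ((a ℤ.+ + 1) ℤ.+ + i))
      index₁ : ∀ a → a ≡ (a ℤ.+ + 1) ℤ.- + 1
      index₁ = ℤSolver.solve-∀

  geometric : Carrier → Carrier → ℕ → ℤ → Carrier
  geometric q r n a = zpow (- 1#) a * pow q n * zpow r a

  geometric-step : ∀ {q r} → ¬ (r ≈ 0#) → q * (r + 1#) ≈ r → ∀ n b →
    geometric q r (suc n) (b ℤ.+ + 1) ≈ geometric q r (suc n) b + geometric q r n (b ℤ.+ + 1)
  geometric-step {q} {r} r≉0 q[r+1]≈r n b = begin
    zpow s (b ℤ.+ + 1) * (q * Q) * zpow r (b ℤ.+ + 1)      ≈⟨ *-cong (*-congʳ s↑) r↑ ⟩
    s * S * (q * Q) * (r * P)                                ≈⟨ +-identityˡ _ ⟨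
    0# + s * S * (q * Q) * (r * P)                           ≈⟨ +-congʳ vanishing ⟨
    S * Q * P * ((1# + s) * q) + s * S * (q * Q) * (r * P)   ≈⟨ expand S Q P q r s ⟩
    S * Q * P * (q + s * (q * (r + 1#)))                     ≈⟨ *-congˡ (+-congˡ (*-congˡ q[r+1]≈r)) ⟩
    S * Q * P * (q + s * r)                                  ≈⟨ distribute S Q P q r s ⟩
    S * (q * Q) * P + s * S * Q * (r * P)                    ≈⟨ +-congˡ (*-cong (*-congʳ s↑) r↑) ⟨
    S * (q * Q) * P + zpow s (b ℤ.+ + 1) * Q * zpow r (b ℤ.+ + 1) ∎
    where
    s S Q P : Carrier
    s = - 1#
    S = zpow s b
    Q = pow q n
    P = zpow r b
    s↑ : zpow s (b ℤ.+ + 1) ≈ s * S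
    s↑ = zpow-+1 -1≉0 b
    r↑ : zpow r (b ℤ.+ + 1) ≈ r * P
    r↑ = zpow-+1 r≉0 b
    -- The solver does not know s = -1; adding this zero term lets it bring q (r + 1) into view.
    vanishing : S * Q * P * ((1# + s) * q) ≈ 0#
    vanishing = trans (*-congˡ (trans (*-congʳ (-‿inverseʳ 1#)) (zeroˡ q))) (zeroʳ _)
    expand : ∀ S Q P q r s → S * Q * P * ((1# + s) * q) + s * S * (q * Q) * (r * P)
                             ≈ S * Q * P * (q + s * (q * (r + 1#)))
    expand = solve 6 (λ S Q P q r s → S :* Q :* P :* ((con 1 :+ s) :* q) :+ s :* S :* (q :* Q) :* (r :* P)
                                       := S :* Q :* P :* (q :+ s :* (q :* (r :+ con 1)))) refl
    distribute : ∀ S Q P q r s → S * Q * P * (q + s * r) ≈ S * (q * Q) * P + s * S * Q * (r * P)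
    distribute = solve 6 (λ S Q P q r s → S :* Q :* P :* (q :+ s :* r)
                                           := S :* (q :* Q) :* P :+ s :* S :* Q :* (r :* P)) refl

  binomialSum : ℤ → (ℕ → Carrier) → ℕ → ℤ → Carrier
  binomialSum c u n a = sumℕ n (λ j → u (n ℕ.∸ j) * fromℤ (binomℤ (a ℤ.+ + j ℤ.- c) j))

  binomialSum-step : ∀ c u n b →
    binomialSum c u (suc n) (b ℤ.+ + 1) ≈ binomialSum c u (suc n) b + binomialSum c u n (b ℤ.+ + 1)
  binomialSum-step c u n b = begin
    binomialSum c u (suc n) (b ℤ.+ + 1)                      ≈⟨ sumℕ-head n _ ⟩
    t₀ + sumℕ n shifted                                      ≈⟨ +-congˡ (sumℕ-cong n pascal) ⟩
    t₀ + sumℕ n (λ j → A j + B j)                            ≈⟨ +-congˡ (sumℕ-+ n A B) ⟩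
    t₀ + (sumℕ n A + sumℕ n B)                               ≈⟨ +-assoc _ _ _ ⟨
    t₀ + sumℕ n A + sumℕ n B                                 ≈⟨ +-congʳ (sumℕ-head n _) ⟨
    binomialSum c u (suc n) b + binomialSum c u n (b ℤ.+ + 1) ∎
    where
    -- The j = 0 terms on both sides agree by computation, as binomℤ N 0 reduces to + 1.
    t₀ : Carrier
    t₀ = u (suc n) * fromℤ (binomℤ (b ℤ.+ + 1 ℤ.+ + 0 ℤ.- c) 0)
    shifted A B : ℕ → Carrier
    shifted j = u (n ℕ.∸ j) * fromℤ (binomℤ (b ℤ.+ + 1 ℤ.+ + suc j ℤ.- c) (suc j))
    A j = u (n ℕ.∸ j) * fromℤ (binomℤ (b ℤ.+ + suc j ℤ.- c) (suc j))
    B j = u (n ℕ.∸ j) * fromℤ (binomℤ (b ℤ.+ + 1 ℤ.+ + j ℤ.- c) j)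
    index₁ : ∀ b c J → b ℤ.+ + 1 ℤ.+ (+ 1 ℤ.+ J) ℤ.- c ≡ b ℤ.+ (+ 1 ℤ.+ J) ℤ.- c ℤ.+ + 1
    index₁ = ℤSolver.solve-∀
    index₂ : ∀ b c J → b ℤ.+ (+ 1 ℤ.+ J) ℤ.- c ≡ b ℤ.+ + 1 ℤ.+ J ℤ.- c
    index₂ = ℤSolver.solve-∀
    pascal : ∀ j → shifted j ≈ A j + B j
    pascal j = begin
      shifted j
        ≈⟨ *-congˡ (reflexive (≡.cong fromℤ binomials)) ⟩
      u (n ℕ.∸ j) * fromℤ (binomℤ N (suc j) ℤ.+ binomℤ N′ j)
        ≈⟨ *-congˡ (fromℤ-+ (binomℤ N (suc j)) (binomℤ N′ j)) ⟩
      u (n ℕ.∸ j) * (fromℤ (binomℤ N (suc j)) + fromℤ (binomℤ N′ j))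
        ≈⟨ distribˡ _ _ _ ⟩
      A j + B j
        ∎
      where
      N N′ : ℤ
      N  = b ℤ.+ + suc j ℤ.- c
      N′ = b ℤ.+ + 1 ℤ.+ + j ℤ.- c
      binomials : binomℤ (b ℤ.+ + 1 ℤ.+ + suc j ℤ.- c) (suc j) ≡ binomℤ N (suc j) ℤ.+ binomℤ N′ j
      binomials = ≡.trans (≡.cong (λ z → binomℤ z (suc j)) (index₁ b c (+ j)))
                 (≡.trans (binomℤ-pascal N j) (≡.cong (λ z → binomℤ N (suc j) ℤ.+ binomℤ z j) (index₂ b c (+ j))))

  binomialSum-boundary : ∀ c u n → binomialSum c u (suc n) (c ℤ.- + 1) ≈ u (suc n)
  binomialSum-boundary c u n = begin
    binomialSum c u (suc n) (c ℤ.- + 1)          ≈⟨ sumℕ-head n _ ⟩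
    u (suc n) * (1# + 0#) + sumℕ n vanishing
      ≈⟨ +-cong (*-congˡ (+-identityʳ 1#)) (sumℕ-≈0 n vanishing vanishes) ⟩
    u (suc n) * 1# + 0#                          ≈⟨ +-identityʳ _ ⟩
    u (suc n) * 1#                               ≈⟨ *-identityʳ _ ⟩
    u (suc n)                                    ∎
    where
    vanishing : ℕ → Carrier
    vanishing j = u (n ℕ.∸ j) * fromℤ (binomℤ (c ℤ.- + 1 ℤ.+ + suc j ℤ.- c) (suc j))
    index : ∀ c J → c ℤ.- + 1 ℤ.+ (+ 1 ℤ.+ J) ℤ.- c ≡ J
    index = ℤSolver.solve-∀
    vanishes : ∀ j → vanishing j ≈ 0#
    vanishes j = trans (*-congˡ (reflexive (≡.cong fromℤ
                   (≡.trans (≡.cong (λ z → binomℤ z (suc j)) (index c (+ j))) (binomℤ-vanish j)))))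
                 (zeroʳ _)

  iterSum-alternating-geometric : ∀ {q r} → ¬ (r ≈ 0#) → q * (r + 1#) ≈ r → ∀ c n a →
    iterSum c n (λ a₀ → zpow (- 1#) a₀ * zpow r a₀) a
      ≈ geometric q r n a + zpow (- 1#) c * binomialSum c (λ k → pow q k * zpow r (c ℤ.- + 1)) n a
  iterSum-alternating-geometric {q} {r} r≉0 q[r+1]≈r c = iterSum≈closedForm
    where
    s : Carrier
    s = - 1#
    summand : ℤ → Carrier
    summand a₀ = zpow s a₀ * zpow r a₀
    u : ℕ → Carrier
    u k = pow q k * zpow r (c ℤ.- + 1)
    closedForm : ℕ → ℤ → Carrier
    closedForm n a = geometric q r n a + zpow s c * binomialSum c u n a

    closedForm-boundary : ∀ n → closedForm (suc n) (c ℤ.- + 1) ≈ 0#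
    closedForm-boundary n = begin
      S * Q * R + zpow s c * binomialSum c u (suc n) (c ℤ.- + 1)
        ≈⟨ +-congˡ (*-cong s↑ (binomialSum-boundary c u n)) ⟩
      S * Q * R + s * S * (Q * R)   ≈⟨ factor S Q R s ⟩
      S * Q * R * (1# + s)          ≈⟨ *-congˡ (-‿inverseʳ 1#) ⟩
      S * Q * R * 0#                ≈⟨ zeroʳ _ ⟩
      0#                            ∎
      where
      S Q R : Carrier
      S = zpow s (c ℤ.- + 1)
      Q = pow q (suc n)
      R = zpow r (c ℤ.- + 1)
      index : ∀ c → c ≡ c ℤ.- + 1 ℤ.+ + 1
      index = ℤSolver.solve-∀
      s↑ : zpow s c ≈ s * S
      s↑ = trans (reflexive (≡.cong (zpow s) (index c))) (zpow-+1 -1≉0 (c ℤ.- + 1))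
      factor : ∀ S Q R s → S * Q * R + s * S * (Q * R) ≈ S * Q * R * (1# + s)
      factor = solve 4 (λ S Q R s → S :* Q :* R :+ s :* S :* (Q :* R) := S :* Q :* R :* (con 1 :+ s)) refl

    closedForm-step : ∀ n b →
      closedForm (suc n) (b ℤ.+ + 1) ≈ closedForm (suc n) b + closedForm n (b ℤ.+ + 1)
    closedForm-step n b = trans
      (+-cong (geometric-step r≉0 q[r+1]≈r n b) (*-congˡ (binomialSum-step c u n b)))
      (interchange _ _ (zpow s c) _ _)
      where
      interchange : ∀ P W S X Y → P + W + S * (X + Y) ≈ P + S * X + (W + S * Y)
      interchange = solve 5 (λ P W S X Y → P :+ W :+ S :* (X :+ Y) := P :+ S :* X :+ (W :+ S :* Y)) refl

    iterSum≈closedForm : ∀ n a → iterSum c n summand a ≈ closedForm n a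
    iterSum≈closedForm zero    a = pad (zpow s a) (zpow r a) (zpow s c)
      where
      pad : ∀ A B C → A * B ≈ A * 1# * B + C * 0#
      pad = solve 3 (λ A B C → A :* B := A :* con 1 :* B :+ C :* con 0) refl
    iterSum≈closedForm (suc n)   =
      zsum-unique (iterSum c n summand) (closedForm (suc n)) step c (closedForm-boundary n)
      where
      step : ∀ b → closedForm (suc n) (b ℤ.+ + 1) ≈ closedForm (suc n) b + iterSum c n summand (b ℤ.+ + 1)
      step b = trans (closedForm-step n b) (+-congˡ (sym (iterSum≈closedForm n (b ℤ.+ + 1))))

mainTheorem4 : ∀ {c ℓ : Level} (F : Field c ℓ) → let open Field F in let open FieldOps F in
    (n : ℕ) → .{{_ : NonZero n}} → (aₙ cc : ℤ) → (x y : Carrier) →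
    ¬ (x ≈ 0#) → ¬ (y ≈ 0#) → ¬ (x + y ≈ 0#) →
    iterSum cc n (λ a₀ → zpow (- 1#) a₀ * zpow (x / y) a₀) aₙ
      ≈ zpow (- 1#) aₙ * pow (x / (x + y)) n * zpow (x / y) aₙ
        + zpow (- 1#) cc * sumℕ n (λ j → pow (x / (x + y)) (n ℕ.∸ j) * zpow (x / y) (cc ℤ.- + 1) * fromℤ (binomℤ (aₙ ℤ.+ + j ℤ.- cc) j))
mainTheorem4 F n aₙ cc x y x≉0 y≉0 x+y≉0 =
  iterSum-alternating-geometric F (x/y≉0 F x≉0 y≉0) (x/[x+y]*[x/y+1]≈x/y F y≉0 x+y≉0) cc n aₙ
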